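{- Let $n\ge 2$ and $\alpha,\alpha'\in\mathbb{Z}_{n!}$. The permutations $p_\alpha,p_{\alpha'}\in\mathcal{S}_n$ are mirror images of one another (i.e. $p_{\alpha'}=\overline{p_\alpha}$) if and only if $\alpha+\alpha'=-1$ in $\mathbb{Z}_{n!}$.
   Context: For $m\ge1$, $\mathcal{S}_m$ is the set of permutations (words using each symbol once) of distinct symbols $x_1,\ldots,x_m$, ordered by generation by cyclic shift: $\mathcal{S}_1=((x_1))$, and if $\mathcal{S}_{m-1}=(q_0,\ldots,q_{(m-1)!-1})$ then $\mathcal{S}_m=(p_0,\ldots,p_{m!-1})$ with $p_{m\beta+j}=C^j(q_\beta x_m)$ for $0\le j\le m-1$, where $q_\beta x_m$ appends $x_m$ on the right and $C(c_1c_2\cdots c_m)=(c_2\cdots c_mc_1)$. Indices (ranks) are viewed as elements of $\mathbb{Z}_{n!}$, the integers modulo $n!$, identified with $\{0,\ldots,n!-1\}$. The mirror image of $p=(a_1a_2\cdots a_n)$ is $\overline p=(a_n\cdots a_2a_1)$. -}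

module Defs where

open import Data.Nat using (ℕ; zero; suc)
open import Data.Nat.DivMod using (_/_; _%_)
open import Data.List using (List; []; _∷_; _++_; [_])

C : List ℕ → List ℕ
C []       = []
C (c ∷ cs) = cs ++ [ c ]

Cⁿ : ℕ → List ℕ → List ℕ
Cⁿ zero    w = w
Cⁿ (suc j) w = C (Cⁿ j w)

-- perm m k = p_k ∈ 𝒮_m (the permutation of rank k, for k < m!),
-- symbol x_i represented by the natural number i.
perm : ℕ → ℕ → List ℕ
perm zero    k = []
perm (suc m) k = Cⁿ (k % suc m) (perm m (k / suc m) ++ [ suc m ])

-- Writing k = j + β·(m+1) with j < m+1, the rank-k word of 𝒮_{m+1} is the
-- j-fold rotation of q_β x_{m+1}. Mirroring a rotation by j of a word of length
-- m+1 is the rotation by m+1−j of the mirrored word, and rotating x_{m+1} q̄_β by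
-- one step gives q̄_β x_{m+1}; so the mirror of p_k is the rotation by m−j of
-- q̄_β x_{m+1}. By induction q̄_β = q_{β′} whenever β + β′ + 1 = m!, and
-- k + k′ + 1 = (m+1)! splits exactly into j + j′ = m and β + β′ + 1 = m!.
-- The converse follows from injectivity of the ranking, which holds because
-- x_{m+1} occurs in p_k exactly j positions from the end.
module Submission where

open import Defs
open import Data.Nat using (ℕ; _+_; _≤_)
open import Data.Nat.DivMod using (_%_)
open import Data.Nat using (_!)
open import Data.Fin using (Fin; toℕ)
open import Data.List using (reverse)
open import Data.Nat.Properties using (_!≢0)
open import Function.Bundles using (_⇔_)
open import Relation.Binary.PropositionalEquality using (_≡_)

open import Data.Nat using (zero; suc; _*_; _∸_; _<_; s≤s; s≤s⁻¹; NonZero)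
open import Data.Nat.Properties
open import Data.Nat.DivMod using (_/_; m≡m%n+[m/n]*n; [m+kn]%n≡m%n; m*n%n≡0; m%n<n; m<n*o⇒m/o<n; n%n≡0)
open import Data.Nat.Divisibility using (divides; m%n≡0⇒n∣m)
open import Data.Nat.Tactic.RingSolver using (solve-∀)
open import Data.List using (List; []; _∷_; _++_; [_]; length; take; drop)
open import Data.List.Properties
  using (length-++; ++-assoc; ++-identityʳ; take++drop≡id; length-take; length-drop; reverse-++; length-reverse; ∷-injective; ∷-injectiveˡ)
open import Data.List.Relation.Unary.All using (All; []; _∷_)
import Data.List.Relation.Unary.All as All
open import Data.List.Relation.Unary.All.Properties using (++⁺; drop⁺)
open import Data.Product using (_×_; _,_; proj₁; proj₂)
open import Data.Fin.Properties using (toℕ<n)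
open import Function.Bundles using (mk⇔)
open import Relation.Binary.PropositionalEquality using (_≢_; refl; sym; trans; cong; cong₂; module ≡-Reasoning)
open import Relation.Nullary using (contradiction)

open ≡-Reasoning

length-C : ∀ w → length (C w) ≡ length w
length-C []       = refl
length-C (c ∷ cs) = trans (length-++ cs) (+-comm (length cs) 1)

length-Cⁿ : ∀ j w → length (Cⁿ j w) ≡ length w
length-Cⁿ zero    w = refl
length-Cⁿ (suc j) w = trans (length-C (Cⁿ j w)) (length-Cⁿ j w)

All-C : ∀ {P : ℕ → Set} {w} → All P w → All P (C w)
All-C []         = []
All-C (pc ∷ pcs) = ++⁺ pcs (pc ∷ [])

All-Cⁿ : ∀ {P : ℕ → Set} j {w} → All P w → All P (Cⁿ j w)
All-Cⁿ zero    pw = pw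
All-Cⁿ (suc j) pw = All-C (All-Cⁿ j pw)

Cⁿ-suc : ∀ j w → Cⁿ (suc j) w ≡ Cⁿ j (C w)
Cⁿ-suc zero    w = refl
Cⁿ-suc (suc j) w = cong C (Cⁿ-suc j w)

Cⁿ-length-++ : ∀ (b c : List ℕ) → Cⁿ (length b) (b ++ c) ≡ c ++ b
Cⁿ-length-++ []      c = sym (++-identityʳ c)
Cⁿ-length-++ (x ∷ b) c = begin
  Cⁿ (suc (length b)) (x ∷ b ++ c) ≡⟨ Cⁿ-suc (length b) (x ∷ b ++ c) ⟩
  Cⁿ (length b) ((b ++ c) ++ [ x ]) ≡⟨ cong (Cⁿ (length b)) (++-assoc b c [ x ]) ⟩
  Cⁿ (length b) (b ++ c ++ [ x ])   ≡⟨ Cⁿ-length-++ b (c ++ [ x ]) ⟩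
  (c ++ [ x ]) ++ b                 ≡⟨ ++-assoc c [ x ] b ⟩
  c ++ x ∷ b                        ∎

length-take-≤ : ∀ j (w : List ℕ) → j ≤ length w → length (take j w) ≡ j
length-take-≤ j w j≤ = trans (length-take j w) (m≤n⇒m⊓n≡m j≤)

Cⁿ-take-drop : ∀ j w → j ≤ length w → Cⁿ j w ≡ drop j w ++ take j w
Cⁿ-take-drop j w j≤ = begin
  Cⁿ j w                                     ≡⟨ cong₂ Cⁿ (sym (length-take-≤ j w j≤)) (sym (take++drop≡id j w)) ⟩
  Cⁿ (length (take j w)) (take j w ++ drop j w) ≡⟨ Cⁿ-length-++ (take j w) (drop j w) ⟩
  drop j w ++ take j w                       ∎

reverse-Cⁿ : ∀ j w → j ≤ length w → reverse (Cⁿ j w) ≡ Cⁿ (length w ∸ j) (reverse w)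
reverse-Cⁿ j w j≤ = begin
  reverse (Cⁿ j w)                           ≡⟨ cong reverse (Cⁿ-take-drop j w j≤) ⟩
  reverse (c ++ b)                           ≡⟨ reverse-++ c b ⟩
  reverse b ++ reverse c                     ≡⟨ Cⁿ-length-++ (reverse c) (reverse b) ⟨
  Cⁿ (length (reverse c)) (reverse c ++ reverse b)
    ≡⟨ cong₂ Cⁿ (trans (length-reverse c) (length-drop j w)) (sym (reverse-++ b c)) ⟩
  Cⁿ (length w ∸ j) (reverse (b ++ c))       ≡⟨ cong (λ u → Cⁿ (length w ∸ j) (reverse u)) (take++drop≡id j w) ⟩
  Cⁿ (length w ∸ j) (reverse w)              ∎
  where
  b = take j w
  c = drop j w

++-∷-injective : ∀ {A : Set} {x : A} {xs ys xs′ ys′ : List A} → All (_≢ x) xs → All (_≢ x) xs′ →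
                 xs ++ x ∷ ys ≡ xs′ ++ x ∷ ys′ → xs ≡ xs′ × ys ≡ ys′
++-∷-injective []         []          refl = refl , refl
++-∷-injective []         (y′≢x ∷ _)  eq   = contradiction (sym (∷-injectiveˡ eq)) y′≢x
++-∷-injective (y≢x ∷ _)  []          eq   = contradiction (∷-injectiveˡ eq) y≢x
++-∷-injective (_ ∷ pxs)  (_ ∷ pxs′)  eq   with ∷-injective eq
... | y≡y′ , eq′ with ++-∷-injective pxs pxs′ eq′
...   | xs≡xs′ , ys≡ys′ = cong₂ _∷_ y≡y′ xs≡xs′ , ys≡ys′

x+y+1<n+n : ∀ {x y n} → x < n → y < n → x + y + 1 < n + n
x+y+1<n+n {x} {y} x<n y<n = ≤-trans (≤-reflexive (cong suc (+-comm (x + y) 1))) (+-mono-≤-< x<n y<n)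

[x+y+1]%n≡0⇒x+y+1≡n : ∀ {x y} n .{{_ : NonZero n}} → x < n → y < n → (x + y + 1) % n ≡ 0 → x + y + 1 ≡ n
[x+y+1]%n≡0⇒x+y+1≡n {x} {y} n x<n y<n s%n≡0 with m%n≡0⇒n∣m (x + y + 1) n s%n≡0
... | divides zero          s≡0 = contradiction (trans (+-comm 1 (x + y)) s≡0) λ ()
... | divides 1             s≡n = trans s≡n (+-identityʳ n)
... | divides (suc (suc c)) s≡  = contradiction (x+y+1<n+n x<n y<n) (≤⇒≯ n+n≤s)
  where
  n+n≤s : n + n ≤ x + y + 1
  n+n≤s = ≤-trans (+-monoʳ-≤ n (m≤m+n n (c * n))) (≤-reflexive (sym s≡))

-- The remainder part j + j′ + 1 is a multiple of N strictly between 0 and 2N.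
complement-%-/ : ∀ k k′ N M .{{_ : NonZero N}} → k + k′ + 1 ≡ N * M →
                 k % N + k′ % N + 1 ≡ N × k / N + k′ / N + 1 ≡ M
complement-%-/ k k′ N M eq = s≡N , *-cancelʳ-≡ _ M N quotients
  where
  j = k % N
  j′ = k′ % N
  β = k / N
  β′ = k′ / N
  rearrange : ∀ j j′ β β′ N → (j + j′ + 1) + (β + β′) * N ≡ (j + β * N) + (j′ + β′ * N) + 1
  rearrange = solve-∀
  split : (j + j′ + 1) + (β + β′) * N ≡ M * N
  split = begin
    (j + j′ + 1) + (β + β′) * N     ≡⟨ rearrange j j′ β β′ N ⟩
    (j + β * N) + (j′ + β′ * N) + 1 ≡⟨ cong₂ (λ u v → u + v + 1) (m≡m%n+[m/n]*n k N) (m≡m%n+[m/n]*n k′ N) ⟨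
    k + k′ + 1                      ≡⟨ eq ⟩
    N * M                           ≡⟨ *-comm N M ⟩
    M * N                           ∎
  s≡N : j + j′ + 1 ≡ N
  s≡N = [x+y+1]%n≡0⇒x+y+1≡n N (m%n<n k N) (m%n<n k′ N) (begin
    (j + j′ + 1) % N                 ≡⟨ [m+kn]%n≡m%n (j + j′ + 1) (β + β′) N ⟨
    ((j + j′ + 1) + (β + β′) * N) % N ≡⟨ cong (_% N) split ⟩
    (M * N) % N                      ≡⟨ m*n%n≡0 M N ⟩
    0                                ∎)
  quotients : (β + β′ + 1) * N ≡ M * N
  quotients = begin
    (β + β′ + 1) * N            ≡⟨ cong (_* N) (+-comm (β + β′) 1) ⟩
    N + (β + β′) * N            ≡⟨ cong (_+ (β + β′) * N) s≡N ⟨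
    (j + j′ + 1) + (β + β′) * N ≡⟨ split ⟩
    M * N                       ∎

length-perm : ∀ m k → length (perm m k) ≡ m
length-perm zero    k = refl
length-perm (suc m) k = begin
  length (Cⁿ (k % suc m) (q ++ [ suc m ])) ≡⟨ length-Cⁿ (k % suc m) (q ++ [ suc m ]) ⟩
  length (q ++ [ suc m ])                  ≡⟨ length-++ q ⟩
  length q + 1                             ≡⟨ cong (_+ 1) (length-perm m (k / suc m)) ⟩
  m + 1                                    ≡⟨ +-comm m 1 ⟩
  suc m                                    ∎
  where q = perm m (k / suc m)

perm-< : ∀ m k → All (_< suc m) (perm m k)
perm-< zero    k = []
perm-< (suc m) k = All-Cⁿ (k % suc m) (++⁺ (All.map m≤n⇒m≤1+n (perm-< m (k / suc m))) (≤-refl ∷ []))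

%-suc-≤ : ∀ k m → k % suc m ≤ m
%-suc-≤ k m = s≤s⁻¹ (m%n<n k (suc m))

perm-suc : ∀ m k → let j = k % suc m; q = perm m (k / suc m) in
           perm (suc m) k ≡ drop j q ++ suc m ∷ take j q
perm-suc m k = begin
  Cⁿ j (q ++ [ suc m ])                             ≡⟨ cong₂ Cⁿ (sym j≡) (cong (_++ [ suc m ]) (sym (take++drop≡id j q))) ⟩
  Cⁿ (length (take j q)) ((take j q ++ drop j q) ++ [ suc m ])
    ≡⟨ cong (Cⁿ (length (take j q))) (++-assoc (take j q) (drop j q) [ suc m ]) ⟩
  Cⁿ (length (take j q)) (take j q ++ drop j q ++ [ suc m ])
    ≡⟨ Cⁿ-length-++ (take j q) (drop j q ++ [ suc m ]) ⟩
  (drop j q ++ [ suc m ]) ++ take j q              ≡⟨ ++-assoc (drop j q) [ suc m ] (take j q) ⟩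
  drop j q ++ suc m ∷ take j q                     ∎
  where
  j = k % suc m
  q = perm m (k / suc m)
  j≡ : length (take j q) ≡ j
  j≡ = length-take-≤ j q (≤-trans (%-suc-≤ k m) (≤-reflexive (sym (length-perm m (k / suc m)))))

perm-mirror : ∀ n k k′ → k + k′ + 1 ≡ n ! → perm n k′ ≡ reverse (perm n k)
perm-mirror zero    k k′ eq = refl
perm-mirror (suc m) k k′ eq = begin
  Cⁿ j′ (perm m β′ ++ [ N ])                ≡⟨ cong₂ (λ i u → Cⁿ i (u ++ [ N ])) j′≡m∸j (perm-mirror m β β′ quotients) ⟩
  Cⁿ (m ∸ j) (reverse q ++ [ N ])           ≡⟨ Cⁿ-suc (m ∸ j) (N ∷ reverse q) ⟨
  Cⁿ (suc (m ∸ j)) (N ∷ reverse q)          ≡⟨ cong₂ Cⁿ (sym length∸j) (sym (reverse-++ q [ N ])) ⟩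
  Cⁿ (length (q ++ [ N ]) ∸ j) (reverse (q ++ [ N ])) ≡⟨ reverse-Cⁿ j (q ++ [ N ]) (≤-trans (m≤n⇒m≤1+n j≤m) (≤-reflexive (sym length≡))) ⟨
  reverse (Cⁿ j (q ++ [ N ]))               ∎
  where
  N = suc m
  j = k % N
  j′ = k′ % N
  β = k / N
  β′ = k′ / N
  q = perm m β
  j≤m : j ≤ m
  j≤m = %-suc-≤ k m
  parts = complement-%-/ k k′ N (m !) eq
  quotients = proj₂ parts
  j′≡m∸j : j′ ≡ m ∸ j
  j′≡m∸j = begin
    j′           ≡⟨ m+n∸m≡n j j′ ⟨
    j + j′ ∸ j   ≡⟨ cong (_∸ j) (suc-injective (trans (+-comm 1 (j + j′)) (proj₁ parts))) ⟩
    m ∸ j        ∎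
  length≡ : length (q ++ [ N ]) ≡ N
  length≡ = trans (length-++ q) (trans (cong (_+ 1) (length-perm m β)) (+-comm m 1))
  length∸j : length (q ++ [ N ]) ∸ j ≡ suc (m ∸ j)
  length∸j = trans (cong (_∸ j) length≡) (+-∸-assoc 1 j≤m)

perm-injective : ∀ n {k k′} → k < n ! → k′ < n ! → perm n k ≡ perm n k′ → k ≡ k′
perm-injective zero    {zero}  {zero}  _       _        _  = refl
perm-injective zero    {suc _} {_}     (s≤s ()) _       _
perm-injective zero    {_}     {suc _} _       (s≤s ())  _
perm-injective (suc m) {k}     {k′}    k<      k′<      eq = begin
  k            ≡⟨ m≡m%n+[m/n]*n k N ⟩
  j + β * N    ≡⟨ cong₂ (λ u v → u + v * N) j≡j′ β≡β′ ⟩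
  j′ + β′ * N  ≡⟨ m≡m%n+[m/n]*n k′ N ⟨
  k′           ∎
  where
  N = suc m
  j = k % N
  j′ = k′ % N
  β = k / N
  β′ = k′ / N
  q = perm m β
  q′ = perm m β′
  x_N∉ : ∀ i r → All (_≢ N) (drop i (perm m r))
  x_N∉ i r = drop⁺ i (All.map <⇒≢ (perm-< m r))
  parts : drop j q ≡ drop j′ q′ × take j q ≡ take j′ q′
  parts = ++-∷-injective (x_N∉ j β) (x_N∉ j′ β′) (trans (sym (perm-suc m k)) (trans eq (perm-suc m k′)))
  j≤ : ∀ i → i % N ≤ length (perm m (i / N))
  j≤ i = ≤-trans (%-suc-≤ i m) (≤-reflexive (sym (length-perm m (i / N))))
  j≡j′ : j ≡ j′
  j≡j′ = begin
    j                    ≡⟨ length-take-≤ j q (j≤ k) ⟨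
    length (take j q)    ≡⟨ cong length (proj₂ parts) ⟩
    length (take j′ q′)  ≡⟨ length-take-≤ j′ q′ (j≤ k′) ⟩
    j′                   ∎
  q≡q′ : q ≡ q′
  q≡q′ = begin
    q                        ≡⟨ take++drop≡id j q ⟨
    take j q ++ drop j q     ≡⟨ cong₂ _++_ (proj₂ parts) (proj₁ parts) ⟩
    take j′ q′ ++ drop j′ q′ ≡⟨ take++drop≡id j′ q′ ⟩
    q′                       ∎
  quotient< : ∀ {i} → i < N * m ! → i / N < m !
  quotient< {i} i< = m<n*o⇒m/o<n (≤-trans i< (≤-reflexive (*-comm N (m !))))
  β≡β′ : β ≡ β′
  β≡β′ = perm-injective m (quotient< k<) (quotient< k′<) q≡q′

proposition12 : (n : ℕ) → 2 ≤ n → (α α′ : Fin (n !)) →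
    (perm n (toℕ α′) ≡ reverse (perm n (toℕ α))) ⇔ (_%_ (toℕ α + toℕ α′ + 1) (n !) ⦃ n !≢0 ⦄ ≡ 0)
proposition12 n _ α α′ = mk⇔ mirror⇒complement complement⇒mirror
  where
  instance
    n!-nonZero : NonZero (n !)
    n!-nonZero = n !≢0
  a = toℕ α
  a′ = toℕ α′
  ā = n ! ∸ suc a
  a+ā+1≡n! : a + ā + 1 ≡ n !
  a+ā+1≡n! = trans (+-comm (a + ā) 1) (m+[n∸m]≡n (toℕ<n α))
  ā<n! : ā < n !
  ā<n! = ≤-trans (s≤s (m≤n+m ā a)) (≤-reflexive (trans (+-comm 1 (a + ā)) a+ā+1≡n!))
  mirror⇒complement : perm n a′ ≡ reverse (perm n a) → (a + a′ + 1) % n ! ≡ 0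
  mirror⇒complement eq = begin
    (a + a′ + 1) % n ! ≡⟨ cong (λ i → (a + i + 1) % n !) ā≡a′ ⟨
    (a + ā + 1) % n !  ≡⟨ cong (_% n !) a+ā+1≡n! ⟩
    n ! % n !          ≡⟨ n%n≡0 (n !) ⟩
    0                  ∎
    where
    ā≡a′ : ā ≡ a′
    ā≡a′ = perm-injective n ā<n! (toℕ<n α′) (trans (perm-mirror n a ā a+ā+1≡n!) (sym eq))
  complement⇒mirror : (a + a′ + 1) % n ! ≡ 0 → perm n a′ ≡ reverse (perm n a)
  complement⇒mirror e = perm-mirror n a a′ ([x+y+1]%n≡0⇒x+y+1≡n (n !) (toℕ<n α) (toℕ<n α′) e)
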